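{- Let $\mathcal{R}$ be a patch graph rewrite system, let $C$ be a graph, let $(P_L,T_L)\xrightarrow{\tau}(P_R,T_R)\in\mathcal{R}^{\approx}$ (so $T_L$ is simple), let $J$ be a patch for context $C$ and match $P_L$, and let $G=C\cdot_J P_L$. Suppose that, using this rule and this decomposition of $G$, the rewrite relation yields both $G\to_{\mathcal{R}} C\cdot_{J'}P_R=G'$ and $G\to_{\mathcal{R}} C\cdot_{J''}P_R=G''$. Then $G'\approx G''$.
   Context: A graph $G=(V,E,s,t,\ell)$ over a fixed finite nonempty label set $L$ consists of finite sets $V$ (vertices) and $E$ (edges), maps $s,t:E\to V$ and $\ell:E\to L$; $x\xrightarrow{\alpha}y$ denotes an edge with source $x$, target $y$, label $\alpha$. An unlabeled graph is one over a singleton label set. A graph is simple if distinct edges never share source, target and label. Graphs are disjoint if their vertex sets and their edge sets are disjoint. For disjoint edge sets, the union $(V,E,s,t,\ell)\cup(V',E',s',t',\ell')=(V\cup V',E\cup E',s\cup s',t\cup t',\ell\cup\ell')$. A graph renaming $\phi$ for $G$ consists of bijections $\phi_V:V_1\to V_2$, $\phi_E:E_1\to E_2$ with $V_G\subseteq V_1$, $E_G\subseteq E_1$; $\phi(G)$ has vertices $\phi_V(V_G)$, edges $\phi_E(E_G)$, and $s(\phi_E(e))=\phi_V(s_G(e))$, $t(\phi_E(e))=\phi_V(t_G(e))$, $\ell(\phi_E(e))=\ell_G(e)$. Graphs are isomorphic ($G\approx H$) if $H=\phi(G)$ for some renaming $\phi$. Patch: for disjoint graphs $C$ (context) and $M$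 (match), a patch is a graph $J$ with $E_J\cap(E_C\cup E_M)=\emptyset$, $V_J=s(E_J)\cup t(E_J)$, and each edge going from $V_C$ to $V_M$, from $V_M$ to $V_C$, or from $V_M$ to $V_M$. The patch composition is $C\cdot_J M=C\cup J\cup M$. A patch type $T$ for a graph $G$ is an unlabeled patch for context the one-vertex graph with vertex $\square$ and match $G$. For a patch $J$ (context $C$, match $M$) and patch type $T$ for $M$, an edge $j_s\xrightarrow{\alpha}j_t\in E_J$ adheres to $t_s\to t_t\in E_T$ if $j_s\in V_C\Rightarrow t_s=\square$, $j_s\in V_M\Rightarrow j_s=t_s$, $j_t\in V_C\Rightarrow t_t=\square$, $j_t\in V_M\Rightarrow j_t=t_t$; an adherence map is $f:E_J\to E_T$ with each $e$ adhering to $f(e)$. For an adherence map $h$ and $e\in E_J$: $\mathrm{cxt}_h(e)=\{s(e)\}$ if $s(h(e))=\square$, $=\{t(e)\}$ if $t(h(e))=\square$, and $=\emptyset$ otherwise. A scheme is a pair $(P,T)$ of a graph $P$ and a patch type $T$ for $P$. A quasi patch graph rewrite rule $(P_L,T_L)\xrightarrow{\tau}(P_R,T_R)$ is a pair of schemes with a trace function $\tau:E_{T_R}\to E_{T_L}$ such that for all $e\in E_{T_R}$, $\square\in\{s(e),t(e)\}$ implies $\square\in\{s(\tau(e)),t(\tau(e))\}$. A patch graph rewrite rule is a quasi rule in which $T_L$ is simple. Two (quasi) rules $L_1\xrightarrow{\tau_1}R_1$, $L_2\xrightarrow{\tau_2}R_2$ are isomorphic if there is a graph renaming $\phi$ with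 $\phi_V(\square)=\square$, $\phi$ mapping the patterns and patch types of $L_1,R_1$ to those of $L_2,R_2$, and $\phi_E\circ\tau_1=\tau_2\circ\phi_E$. A patch graph rewrite system $\mathcal{R}$ is a set of patch graph rewrite rules, and $\mathcal{R}^{\approx}$ is its closure under rule isomorphism. Rewrite relation: $C\cdot_J P_L\to_{\mathcal{R}} C\cdot_{J'}P_R$ holds if (i) $(P_L,T_L)\xrightarrow{\tau}(P_R,T_R)\in\mathcal{R}^{\approx}$; (ii) $h_L:E_J\to E_{T_L}$ is an adherence map from patch $J$ to $T_L$; (iii) $h_R:E_{J'}\to E_{T_R}$ is an adherence map from patch $J'$ to $T_R$; (iv) for every $t\in E_{T_R}$ there is a bijection $\sigma:h_R^{ -1}(t)\to h_L^{ -1}(\tau(t))$ with $\ell(e)=\ell(\sigma(e))$ and $\mathrm{cxt}_{h_R}(e)\subseteq\mathrm{cxt}_{h_L}(\sigma(e))$ for every $e\in h_R^{ -1}(t)$. -}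

module Defs where

open import Data.Nat using (ℕ)
import Data.Nat.Properties as ℕP
open import Data.Fin using (Fin)
open import Data.Unit using (⊤; tt)
open import Data.Empty using (⊥)
open import Data.Bool using (if_then_else_)
open import Data.Product using (Σ; ∃; _×_; _,_; proj₁; proj₂)
open import Data.Sum using (_⊎_; inj₁; inj₂)
open import Data.List using (List; []; _∷_; _++_)
open import Data.List.Membership.Propositional using (_∈_)
open import Data.List.Membership.Propositional.Properties using (∈-++⁺ˡ; ∈-++⁺ʳ)
open import Data.List.Relation.Unary.Any using (here; there)
import Data.List.Membership.DecPropositional as DecMem
open import Relation.Nullary using (¬_; Dec; yes; no; does)
open import Relation.Binary.PropositionalEquality using (_≡_; refl; cong)
open import Relation.Binary.Definitions using (DecidableEquality)

data Vtx : Set where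
  □  : Vtx
  vx : ℕ → Vtx

vx-inj : ∀ {m n} → vx m ≡ vx n → m ≡ n
vx-inj refl = refl

_≟V_ : DecidableEquality Vtx
□ ≟V □ = yes refl
□ ≟V vx _ = no λ ()
vx _ ≟V □ = no λ ()
vx m ≟V vx n with m ℕP.≟ n
... | yes refl = yes refl
... | no m≢n = no λ eq → m≢n (vx-inj eq)

open DecMem _≟V_ using () renaming (_∈?_ to _∈V?_)
open DecMem ℕP._≟_ using () renaming (_∈?_ to _∈E?_)

_⊆_ : {X : Set} → List X → List X → Set
xs ⊆ ys = ∀ x → x ∈ xs → x ∈ ys

Bij : {X Y : Set} → (X → Set) → (Y → Set) → (X → Y) → Set
Bij {X} {Y} P Q f =
  (∀ x → P x → Q (f x)) ×
  (∀ x y → P x → P y → f x ≡ f y → x ≡ y) ×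
  (∀ y → Q y → Σ X λ x → P x × f x ≡ y)

record Graph (A : Set) : Set where
  field
    V : List Vtx
    E : List ℕ
    s : ℕ → Vtx
    t : ℕ → Vtx
    ℓ : ℕ → A
    s∈V : ∀ e → e ∈ E → s e ∈ V
    t∈V : ∀ e → e ∈ E → t e ∈ V
open Graph public

Simple : {A : Set} → Graph A → Set
Simple G = ∀ e e' → e ∈ E G → e' ∈ E G →
  s G e ≡ s G e' → t G e ≡ t G e' → ℓ G e ≡ ℓ G e' → e ≡ e'

Disjoint : {A B : Set} → Graph A → Graph B → Set
Disjoint G H = (∀ v → v ∈ V G → v ∈ V H → ⊥) × (∀ e → e ∈ E G → e ∈ E H → ⊥)

Box : Graph ⊤
Box = record { V = □ ∷ [] ; E = [] ; s = λ _ → □ ; t = λ _ → □ ; ℓ = λ _ → tt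
             ; s∈V = λ _ () ; t∈V = λ _ () }

pick : {P : Set} {X : Set} → Dec P → X → X → X
pick d x y = if does d then x else y

private
  pick-∈ : {P X : Set} (d : Dec P) {x y : X} (xs : List X) →
           (P → x ∈ xs) → (¬ P → y ∈ xs) → pick d x y ∈ xs
  pick-∈ (yes p) _ f g = f p
  pick-∈ (no ¬p) _ f g = g ¬p

union3 : {A : Set} → Graph A → Graph A → Graph A → Graph A
union3 C J M = record
  { V = V C ++ V J ++ V M
  ; E = E C ++ E J ++ E M
  ; s = sU
  ; t = tU
  ; ℓ = λ e → pick (e ∈E? E C) (ℓ C e) (pick (e ∈E? E J) (ℓ J e) (ℓ M e))
  ; s∈V = λ e e∈ → pick-∈ (e ∈E? E C) _
      (λ p → ∈-++⁺ˡ (s∈V C e p))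
      (λ ¬p → pick-∈ (e ∈E? E J) _
         (λ q → ∈-++⁺ʳ (V C) (∈-++⁺ˡ (s∈V J e q)))
         (λ ¬q → ∈-++⁺ʳ (V C) (∈-++⁺ʳ (V J) (s∈V M e (inM e e∈ ¬p ¬q)))))
  ; t∈V = λ e e∈ → pick-∈ (e ∈E? E C) _
      (λ p → ∈-++⁺ˡ (t∈V C e p))
      (λ ¬p → pick-∈ (e ∈E? E J) _
         (λ q → ∈-++⁺ʳ (V C) (∈-++⁺ˡ (t∈V J e q)))
         (λ ¬q → ∈-++⁺ʳ (V C) (∈-++⁺ʳ (V J) (t∈V M e (inM e e∈ ¬p ¬q)))))
  }
  where
  sU : ℕ → Vtx
  sU e = pick (e ∈E? E C) (s C e) (pick (e ∈E? E J) (s J e) (s M e))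
  tU : ℕ → Vtx
  tU e = pick (e ∈E? E C) (t C e) (pick (e ∈E? E J) (t J e) (t M e))
  inM : ∀ e → e ∈ E C ++ E J ++ E M → ¬ e ∈ E C → ¬ e ∈ E J → e ∈ E M
  inM e e∈ ¬p ¬q with Data.List.Membership.Propositional.Properties.∈-++⁻ (E C) e∈
  ... | inj₁ p = Data.Empty.⊥-elim (¬p p)
  ... | inj₂ r with Data.List.Membership.Propositional.Properties.∈-++⁻ (E J) r
  ... | inj₁ q = Data.Empty.⊥-elim (¬q q)
  ... | inj₂ m = m

record Renaming : Set where
  field
    V₁ V₂ : List Vtx
    E₁ E₂ : List ℕ
    φV : Vtx → Vtx
    φE : ℕ → ℕ
    bijV : Bij (_∈ V₁) (_∈ V₂) φV
    bijE : Bij (_∈ E₁) (_∈ E₂) φE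
open Renaming public

RenamingFor : {A : Set} → Renaming → Graph A → Set
RenamingFor φ G = (V G ⊆ V₁ φ) × (E G ⊆ E₁ φ)

IsImage : {A : Set} → Renaming → Graph A → Graph A → Set
IsImage φ G H =
  (∀ v → (v ∈ V H → Σ Vtx λ u → u ∈ V G × φV φ u ≡ v) ×
         ((Σ Vtx λ u → u ∈ V G × φV φ u ≡ v) → v ∈ V H)) ×
  (∀ e → (e ∈ E H → Σ ℕ λ d → d ∈ E G × φE φ d ≡ e) ×
         ((Σ ℕ λ d → d ∈ E G × φE φ d ≡ e) → e ∈ E H)) ×
  (∀ e → e ∈ E G →
     (s H (φE φ e) ≡ φV φ (s G e)) ×
     (t H (φE φ e) ≡ φV φ (t G e)) ×
     (ℓ H (φE φ e) ≡ ℓ G e))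

_≈_ : {A : Set} → Graph A → Graph A → Set
G ≈ H = Σ Renaming λ φ → RenamingFor φ G × IsImage φ G H

IsPatch : {A B D : Set} → (C : Graph A) → (M : Graph B) → (J : Graph D) → Set
IsPatch C M J =
  Disjoint C M ×
  (∀ e → e ∈ E J → (e ∈ E C ⊎ e ∈ E M) → ⊥) ×
  (∀ v → (v ∈ V J → Σ ℕ λ e → e ∈ E J × (v ≡ s J e ⊎ v ≡ t J e)) ×
         ((Σ ℕ λ e → e ∈ E J × (v ≡ s J e ⊎ v ≡ t J e)) → v ∈ V J)) ×
  (∀ e → e ∈ E J →
     (s J e ∈ V C × t J e ∈ V M) ⊎
     (s J e ∈ V M × t J e ∈ V C) ⊎
     (s J e ∈ V M × t J e ∈ V M))

_·[_]_ : {A : Set} → Graph A → Graph A → Graph A → Graph A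
C ·[ J ] M = union3 C J M

IsPatchType : {A : Set} → Graph A → Graph ⊤ → Set
IsPatchType G T = IsPatch Box G T

Adheres : {A : Set} → (C M J : Graph A) → Graph ⊤ → ℕ → ℕ → Set
Adheres C M J T j te =
  (s J j ∈ V C → s T te ≡ □) ×
  (s J j ∈ V M → s J j ≡ s T te) ×
  (t J j ∈ V C → t T te ≡ □) ×
  (t J j ∈ V M → t J j ≡ t T te)

AdherenceMap : {A : Set} → (C M J : Graph A) → Graph ⊤ → (ℕ → ℕ) → Set
AdherenceMap C M J T h = ∀ e → e ∈ E J → (h e ∈ E T) × Adheres C M J T e (h e)

cxt : {A : Set} → Graph ⊤ → Graph A → (ℕ → ℕ) → ℕ → List Vtx
cxt T J h e =
  if does (s T (h e) ≟V □) then s J e ∷ []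
  else if does (t T (h e) ≟V □) then t J e ∷ []
  else []

record Rule (L : Set) : Set where
  field
    PL PR : Graph L
    TL TR : Graph ⊤
    τ : ℕ → ℕ
open Rule public

IsQuasiRule : {L : Set} → Rule L → Set
IsQuasiRule r =
  IsPatchType (PL r) (TL r) × IsPatchType (PR r) (TR r) ×
  (∀ e → e ∈ E (TR r) → τ r e ∈ E (TL r)) ×
  (∀ e → e ∈ E (TR r) → (s (TR r) e ≡ □ ⊎ t (TR r) e ≡ □) →
     (s (TL r) (τ r e) ≡ □ ⊎ t (TL r) (τ r e) ≡ □))

IsPatchRule : {L : Set} → Rule L → Set
IsPatchRule r = IsQuasiRule r × Simple (TL r)

RuleIso : {L : Set} → Rule L → Rule L → Set
RuleIso r₁ r₂ = Σ Renaming λ φ →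
  (□ ∈ V₁ φ) × (φV φ □ ≡ □) ×
  RenamingFor φ (PL r₁) × RenamingFor φ (TL r₁) ×
  RenamingFor φ (PR r₁) × RenamingFor φ (TR r₁) ×
  IsImage φ (PL r₁) (PL r₂) × IsImage φ (TL r₁) (TL r₂) ×
  IsImage φ (PR r₁) (PR r₂) × IsImage φ (TR r₁) (TR r₂) ×
  (∀ e → e ∈ E (TR r₁) → φE φ (τ r₁ e) ≡ τ r₂ (φE φ e))

PatchGRS : (L : Set) → Set₁
PatchGRS L = Σ (Rule L → Set) λ R → ∀ r → R r → IsPatchRule r

_≈-closure : {L : Set} → PatchGRS L → Rule L → Set
(R ≈-closure) r = Σ _ λ r₀ → proj₁ R r₀ × RuleIso r₀ r

-- Rewrite relation, with the rule and decomposition fixed: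
-- C ·_J P_L  →_R  C ·_J' P_R  using rule r

RewriteStep : {L : Set} → PatchGRS L → (C : Graph L) → Rule L →
              (J J' : Graph L) → Set
RewriteStep R C r J J' =
  (R ≈-closure) r ×
  IsPatch C (PL r) J × IsPatch C (PR r) J' ×
  Σ (ℕ → ℕ) λ hL → Σ (ℕ → ℕ) λ hR →
    AdherenceMap C (PL r) J (TL r) hL ×
    AdherenceMap C (PR r) J' (TR r) hR ×
    (∀ te → te ∈ E (TR r) →
       Σ (ℕ → ℕ) λ σ →
         Bij (λ e → e ∈ E J' × hR e ≡ te) (λ e → e ∈ E J × hL e ≡ τ r te) σ ×
         (∀ e → e ∈ E J' → hR e ≡ te →
            (ℓ J' e ≡ ℓ J (σ e)) ×
            (cxt (TR r) J' hR e ⊆ cxt (TL r) J hL (σ e))))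

module Submission where

-- 1. A patch J for C and M only touches vertices of C and M, so replacing J by
--    any J₂ related to it by an edge bijection preserving source, target and
--    label gives an isomorphic composition (identity on vertices and on the
--    edges of C and M): `composition-≈`.
-- 2. Since T_L is simple, the adherence map of J to T_L is unique
--    (`adherence-unique`); hence both steps use the same h_L.
-- 3. Each step yields fibrewise bijections σ' : J' → J and σ'' : J'' → J over τ
--    (`Trace`).  The composite σ''⁻¹ ∘ σ' is an edge bijection J' → J'' that
--    preserves labels (σ' and σ'' do) and endpoints: an endpoint in P_R is fixed
--    by the patch-type edge, and an endpoint in C is the unique element of the
--    context set, which shrinks along σ into the subsingleton cxt of T_L
--    (`same-source`, `same-target`; this uses □ ∉ P_R).
-- 4. Simplicity of T_L and □ ∉ P_R transfer from the system to its isomorphism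
--    closure; the theorem then follows from 1–3.

open import Defs
open import Data.Nat using (ℕ; suc)
open import Data.Fin using (Fin)
import Data.Nat.Properties as ℕP
open import Data.Unit using (⊤)
open import Data.Empty using (⊥; ⊥-elim)
open import Data.Product using (Σ; _×_; _,_; proj₁; proj₂)
open import Data.Sum using (_⊎_; inj₁; inj₂)
open import Data.List using (List; _++_)
open import Data.List.Membership.Propositional using (_∈_)
open import Data.List.Membership.Propositional.Properties using (∈-++⁺ˡ; ∈-++⁺ʳ; ∈-++⁻)
open import Data.List.Relation.Unary.Any using (here)
import Data.List.Membership.DecPropositional as DecMem
open import Relation.Nullary using (¬_; Dec; yes; no)
open import Relation.Binary.PropositionalEquality
  using (_≡_; refl; cong; sym; trans; subst; module ≡-Reasoning)

open DecMem ℕP._≟_ using () renaming (_∈?_ to _∈E?_)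

private
  variable
    A : Set

split₃ : {X : Set} {x : X} (xs ys zs : List X) →
         x ∈ xs ++ ys ++ zs → x ∈ xs ⊎ x ∈ ys ⊎ x ∈ zs
split₃ xs ys zs m with ∈-++⁻ xs m
... | inj₁ p = inj₁ p
... | inj₂ m' with ∈-++⁻ ys m'
... | inj₁ q = inj₂ (inj₁ q)
... | inj₂ r = inj₂ (inj₂ r)

in₃ˡ : {X : Set} {x : X} (xs ys zs : List X) → x ∈ xs → x ∈ xs ++ ys ++ zs
in₃ˡ xs ys zs = ∈-++⁺ˡ

in₃ᵐ : {X : Set} {x : X} (xs ys zs : List X) → x ∈ ys → x ∈ xs ++ ys ++ zs
in₃ᵐ xs ys zs m = ∈-++⁺ʳ xs (∈-++⁺ˡ m)

in₃ʳ : {X : Set} {x : X} (xs ys zs : List X) → x ∈ zs → x ∈ xs ++ ys ++ zs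
in₃ʳ xs ys zs m = ∈-++⁺ʳ xs (∈-++⁺ʳ ys m)

pick-yes : {P X : Set} (d : Dec P) {x y : X} → P → pick d x y ≡ x
pick-yes (yes _) _ = refl
pick-yes (no ¬p) p = ⊥-elim (¬p p)

pick-no : {P X : Set} (d : Dec P) {x y : X} → ¬ P → pick d x y ≡ y
pick-no (yes p) ¬p = ⊥-elim (¬p p)
pick-no (no _) _ = refl

record EdgeAgree (G : Graph A) (d : ℕ) (H : Graph A) (e : ℕ) : Set where
  constructor agreeing
  field
    same-s : s G d ≡ s H e
    same-t : t G d ≡ t H e
    same-ℓ : ℓ G d ≡ ℓ H e

agree-sym : {G H : Graph A} {d e : ℕ} → EdgeAgree G d H e → EdgeAgree H e G d
agree-sym (agreeing ps pt pℓ) = agreeing (sym ps) (sym pt) (sym pℓ)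

agree-trans : {G H K : Graph A} {c d e : ℕ} →
  EdgeAgree G c H d → EdgeAgree H d K e → EdgeAgree G c K e
agree-trans (agreeing ps pt pℓ) (agreeing qs qt qℓ) =
  agreeing (trans ps qs) (trans pt qt) (trans pℓ qℓ)

module _ (C J M : Graph A) (e : ℕ) where
  private
    inC = e ∈E? E C
    inJ = e ∈E? E J

  union-C : e ∈ E C → EdgeAgree (union3 C J M) e C e
  union-C p = agreeing (pick-yes inC p) (pick-yes inC p) (pick-yes inC p)

  union-J : ¬ e ∈ E C → e ∈ E J → EdgeAgree (union3 C J M) e J e
  union-J ¬c p = agreeing second second second
    where
    second : {X : Set} {x y z : X} → pick inC x (pick inJ y z) ≡ y
    second = trans (pick-no inC ¬c) (pick-yes inJ p)

  union-M : ¬ e ∈ E C → ¬ e ∈ E J → EdgeAgree (union3 C J M) e M e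
  union-M ¬c ¬j = agreeing third third third
    where
    third : {X : Set} {x y z : X} → pick inC x (pick inJ y z) ≡ z
    third = trans (pick-no inC ¬c) (pick-no inJ ¬j)

module PatchFacts {A B D : Set} (C : Graph A) (M : Graph B) (K : Graph D)
                  (pK : IsPatch C M K) where

  disjoint-V : ∀ {v} → v ∈ V C → v ∈ V M → ⊥
  disjoint-V = proj₁ (proj₁ pK) _

  disjoint-E : ∀ {e} → e ∈ E C → e ∈ E M → ⊥
  disjoint-E = proj₂ (proj₁ pK) _

  patch-∉ : ∀ {e} → e ∈ E K → e ∈ E C ⊎ e ∈ E M → ⊥
  patch-∉ = proj₁ (proj₂ pK) _

  source-side : ∀ {e} → e ∈ E K → s K e ∈ V C ⊎ s K e ∈ V M
  source-side e∈ with proj₂ (proj₂ (proj₂ pK)) _ e∈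
  ... | inj₁ (c , _) = inj₁ c
  ... | inj₂ (inj₁ (m , _)) = inj₂ m
  ... | inj₂ (inj₂ (m , _)) = inj₂ m

  target-side : ∀ {e} → e ∈ E K → t K e ∈ V C ⊎ t K e ∈ V M
  target-side e∈ with proj₂ (proj₂ (proj₂ pK)) _ e∈
  ... | inj₁ (_ , m) = inj₂ m
  ... | inj₂ (inj₁ (_ , c)) = inj₁ c
  ... | inj₂ (inj₂ (_ , m)) = inj₂ m

  -- no patch edge runs from the context to the context
  target-C⇒source-M : ∀ {e} → e ∈ E K → t K e ∈ V C → s K e ∈ V M
  target-C⇒source-M e∈ c with proj₂ (proj₂ (proj₂ pK)) _ e∈
  ... | inj₁ (_ , m) = ⊥-elim (disjoint-V c m)
  ... | inj₂ (inj₁ (m , _)) = m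
  ... | inj₂ (inj₂ (m , _)) = m

  -- every patch vertex is an endpoint of a patch edge, hence in C or M
  vertex-side : ∀ {v} → v ∈ V K → v ∈ V C ⊎ v ∈ V M
  vertex-side v∈ with proj₁ (proj₁ (proj₂ (proj₂ pK)) _) v∈
  ... | e , e∈ , inj₁ refl = source-side e∈
  ... | e , e∈ , inj₂ refl = target-side e∈

EdgeIso : Graph A → Graph A → (ℕ → ℕ) → Set
EdgeIso J₁ J₂ f =
  Bij (_∈ E J₁) (_∈ E J₂) f × (∀ e → e ∈ E J₁ → EdgeAgree J₂ (f e) J₁ e)

-- the vertices of C ·_J M are those of C and M, whatever the patch J
vertex-transfer : (C M J J' : Graph A) → IsPatch C M J → ∀ {v} →
  v ∈ V (C ·[ J ] M) → v ∈ V (C ·[ J' ] M)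
vertex-transfer C M J J' pJ m with split₃ (V C) (V J) (V M) m
... | inj₁ c = in₃ˡ (V C) (V J') (V M) c
... | inj₂ (inj₂ c) = in₃ʳ (V C) (V J') (V M) c
... | inj₂ (inj₁ p) with PatchFacts.vertex-side C M J pJ p
... | inj₁ c = in₃ˡ (V C) (V J') (V M) c
... | inj₂ c = in₃ʳ (V C) (V J') (V M) c

module Composition (C M J₁ J₂ : Graph A) (p₁ : IsPatch C M J₁) (p₂ : IsPatch C M J₂)
  (f : ℕ → ℕ) (iso : EdgeIso J₁ J₂ f) where

  private
    module P₁ = PatchFacts C M J₁ p₁
    module P₂ = PatchFacts C M J₂ p₂
    G₁ = C ·[ J₁ ] M
    G₂ = C ·[ J₂ ] M
    f-maps = proj₁ (proj₁ iso)
    f-inj = proj₁ (proj₂ (proj₁ iso))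
    f-onto = proj₂ (proj₂ (proj₁ iso))

  edge-map : ℕ → ℕ
  edge-map e = pick (e ∈E? E J₁) (f e) e

  edge-map-in : ∀ {e} → e ∈ E J₁ → edge-map e ≡ f e
  edge-map-in {e} = pick-yes (e ∈E? E J₁)

  edge-map-out : ∀ {e} → ¬ e ∈ E J₁ → edge-map e ≡ e
  edge-map-out {e} = pick-no (e ∈E? E J₁)

  outside : ∀ {e} → e ∈ E G₁ → ¬ e ∈ E J₁ → e ∈ E C ⊎ e ∈ E M
  outside m ¬p with split₃ (E C) (E J₁) (E M) m
  ... | inj₁ c = inj₁ c
  ... | inj₂ (inj₁ p) = ⊥-elim (¬p p)
  ... | inj₂ (inj₂ c) = inj₂ c

  outside-G₂ : ∀ {e} → e ∈ E C ⊎ e ∈ E M → e ∈ E G₂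
  outside-G₂ (inj₁ c) = in₃ˡ (E C) (E J₂) (E M) c
  outside-G₂ (inj₂ c) = in₃ʳ (E C) (E J₂) (E M) c

  maps : ∀ e → e ∈ E G₁ → edge-map e ∈ E G₂
  maps e m with e ∈E? E J₁
  ... | yes p = in₃ᵐ (E C) (E J₂) (E M) (f-maps e p)
  ... | no ¬p = outside-G₂ (outside m ¬p)

  mixed : ∀ {x y} → x ∈ E J₁ → y ∈ E G₁ → ¬ y ∈ E J₁ → f x ≡ y → ⊥
  mixed px my ¬py eq = P₂.patch-∉ (subst (_∈ E J₂) eq (f-maps _ px)) (outside my ¬py)

  inj : ∀ x y → x ∈ E G₁ → y ∈ E G₁ → edge-map x ≡ edge-map y → x ≡ y
  inj x y mx my eq with x ∈E? E J₁ | y ∈E? E J₁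
  ... | yes px | yes py = f-inj x y px py eq
  ... | yes px | no ¬py = ⊥-elim (mixed px my ¬py eq)
  ... | no ¬px | yes py = ⊥-elim (mixed py mx ¬px (sym eq))
  ... | no ¬px | no ¬py = eq

  onto : ∀ y → y ∈ E G₂ → Σ ℕ λ x → x ∈ E G₁ × edge-map x ≡ y
  onto y m with split₃ (E C) (E J₂) (E M) m
  ... | inj₁ c = y , in₃ˡ (E C) (E J₁) (E M) c , edge-map-out λ p → P₁.patch-∉ p (inj₁ c)
  ... | inj₂ (inj₂ c) = y , in₃ʳ (E C) (E J₁) (E M) c , edge-map-out λ p → P₁.patch-∉ p (inj₂ c)
  ... | inj₂ (inj₁ q) with f-onto y q
  ... | x , px , fx≡y = x , in₃ᵐ (E C) (E J₁) (E M) px , trans (edge-map-in px) fx≡y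

  agree : ∀ e → e ∈ E G₁ → EdgeAgree G₂ (edge-map e) G₁ e
  agree e m with split₃ (E C) (E J₁) (E M) m
  ... | inj₁ c = subst (λ z → EdgeAgree G₂ z G₁ e) (sym (edge-map-out ¬p))
      (agree-trans (union-C C J₂ M e c) (agree-sym (union-C C J₁ M e c)))
    where
    ¬p : ¬ e ∈ E J₁
    ¬p p = P₁.patch-∉ p (inj₁ c)
  ... | inj₂ (inj₂ c) = subst (λ z → EdgeAgree G₂ z G₁ e) (sym (edge-map-out ¬p))
      (agree-trans (union-M C J₂ M e ¬c ¬q) (agree-sym (union-M C J₁ M e ¬c ¬p)))
    where
    ¬c : ¬ e ∈ E C
    ¬c c' = P₁.disjoint-E c' c
    ¬p : ¬ e ∈ E J₁
    ¬p p = P₁.patch-∉ p (inj₂ c)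
    ¬q : ¬ e ∈ E J₂
    ¬q q = P₂.patch-∉ q (inj₂ c)
  ... | inj₂ (inj₁ p) = subst (λ z → EdgeAgree G₂ z G₁ e) (sym (edge-map-in p))
      (agree-trans (union-J C J₂ M (f e) ¬c₂ (f-maps e p))
        (agree-trans (proj₂ iso e p) (agree-sym (union-J C J₁ M e ¬c₁ p))))
    where
    ¬c₁ : ¬ e ∈ E C
    ¬c₁ c = P₁.patch-∉ p (inj₁ c)
    ¬c₂ : ¬ f e ∈ E C
    ¬c₂ c = P₂.patch-∉ (f-maps e p) (inj₁ c)

  identity-on-vertices : Renaming
  identity-on-vertices = record
    { V₁ = V G₁ ; V₂ = V G₁ ; E₁ = E G₁ ; E₂ = E G₂ ; φV = λ v → v ; φE = edge-map
    ; bijV = (λ _ p → p) , (λ _ _ _ _ eq → eq) , (λ v p → v , p , refl)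
    ; bijE = maps , inj , onto }

  composition-≈ : G₁ ≈ G₂
  composition-≈ = identity-on-vertices , ((λ _ p → p) , (λ _ p → p))
    , (λ v → (λ m → v , vertex-transfer C M J₂ J₁ p₂ m , refl)
           , λ { (u , u∈ , refl) → vertex-transfer C M J₁ J₂ p₁ u∈ })
    , (λ e → onto e , λ { (d , d∈ , refl) → maps d d∈ })
    , (λ e m → let open EdgeAgree (agree e m) in same-s , same-t , same-ℓ)

module AdherenceFacts (C M K : Graph A) (T : Graph ⊤) (h : ℕ → ℕ)
                      (ad : AdherenceMap C M K T h) {e : ℕ} (e∈ : e ∈ E K) where
  source-in-C : s K e ∈ V C → s T (h e) ≡ □
  source-in-C = proj₁ (proj₂ (ad e e∈))

  source-in-M : s K e ∈ V M → s K e ≡ s T (h e)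
  source-in-M = proj₁ (proj₂ (proj₂ (ad e e∈)))

  target-in-C : t K e ∈ V C → t T (h e) ≡ □
  target-in-C = proj₁ (proj₂ (proj₂ (proj₂ (ad e e∈))))

  target-in-M : t K e ∈ V M → t K e ≡ t T (h e)
  target-in-M = proj₂ (proj₂ (proj₂ (proj₂ (ad e e∈))))

adherence-unique : (C M K : Graph A) (T : Graph ⊤) {h h' : ℕ → ℕ} →
  IsPatch C M K → Simple T →
  AdherenceMap C M K T h → AdherenceMap C M K T h' → ∀ d → d ∈ E K → h d ≡ h' d
adherence-unique C M K T {h} {h'} pK simple ad ad' d d∈ =
  simple (h d) (h' d) (proj₁ (ad d d∈)) (proj₁ (ad' d d∈)) same-s same-t refl
  where
  open PatchFacts C M K pK
  module A = AdherenceFacts C M K T h ad d∈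
  module A' = AdherenceFacts C M K T h' ad' d∈
  same-s : s T (h d) ≡ s T (h' d)
  same-s with source-side d∈
  ... | inj₁ c = trans (A.source-in-C c) (sym (A'.source-in-C c))
  ... | inj₂ m = trans (sym (A.source-in-M m)) (A'.source-in-M m)
  same-t : t T (h d) ≡ t T (h' d)
  same-t with target-side d∈
  ... | inj₁ c = trans (A.target-in-C c) (sym (A'.target-in-C c))
  ... | inj₂ m = trans (sym (A.target-in-M m)) (A'.target-in-M m)

Subsingleton : List Vtx → Set
Subsingleton xs = ∀ {a b} → a ∈ xs → b ∈ xs → a ≡ b

cxt-subsingleton : (T : Graph ⊤) (K : Graph A) (h : ℕ → ℕ) (e : ℕ) →
  Subsingleton (cxt T K h e)
cxt-subsingleton T K h e p q with s T (h e) ≟V □ | t T (h e) ≟V □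
cxt-subsingleton T K h e (here refl) (here refl) | yes _ | _ = refl
cxt-subsingleton T K h e (here refl) (here refl) | no _ | yes _ = refl
cxt-subsingleton T K h e () q | no _ | no _

cxt-cong : (T : Graph ⊤) (K : Graph A) (h h' : ℕ → ℕ) (e : ℕ) →
  h e ≡ h' e → cxt T K h e ≡ cxt T K h' e
cxt-cong T K h h' e eq rewrite eq = refl

cxt-source : (T : Graph ⊤) (K : Graph A) (h : ℕ → ℕ) (e : ℕ) →
  s T (h e) ≡ □ → s K e ∈ cxt T K h e
cxt-source T K h e eq with s T (h e) ≟V □
... | yes _ = here refl
... | no n = ⊥-elim (n eq)

cxt-target : (T : Graph ⊤) (K : Graph A) (h : ℕ → ℕ) (e : ℕ) →
  ¬ s T (h e) ≡ □ → t T (h e) ≡ □ → t K e ∈ cxt T K h e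
cxt-target T K h e ns eq with s T (h e) ≟V □ | t T (h e) ≟V □
... | yes y | _ = ⊥-elim (ns y)
... | no _ | yes _ = here refl
... | no _ | no n = ⊥-elim (n eq)

-- a target in the context forces the source into the match, which avoids □;
-- so the context set of the edge records its target
target-in-cxt : (C M K : Graph A) (T : Graph ⊤) (h : ℕ → ℕ) → ¬ □ ∈ V M →
  IsPatch C M K → AdherenceMap C M K T h →
  ∀ {e} → e ∈ E K → t K e ∈ V C → t K e ∈ cxt T K h e
target-in-cxt C M K T h □∉M pK ad {e} e∈ c =
  cxt-target T K h e source-not-□ (AdherenceFacts.target-in-C C M K T h ad e∈ c)
  where
  m : s K e ∈ V M
  m = PatchFacts.target-C⇒source-M C M K pK e∈ c
  source-not-□ : ¬ s T (h e) ≡ □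
  source-not-□ eq =
    □∉M (subst (_∈ V M) (trans (AdherenceFacts.source-in-M C M K T h ad e∈ m) eq) m)

-- The endpoints of a patch edge are determined by its patch-type edge together
-- with its context set: an endpoint in M is the corresponding endpoint of the
-- patch-type edge, and an endpoint in C is the element of the context set.
module SameEndpoints (C M : Graph A) (T : Graph ⊤) (□∉M : ¬ □ ∈ V M)
  (K₁ K₂ : Graph A) (p₁ : IsPatch C M K₁) (p₂ : IsPatch C M K₂)
  {h₁ h₂ : ℕ → ℕ} (ad₁ : AdherenceMap C M K₁ T h₁) (ad₂ : AdherenceMap C M K₂ T h₂)
  {e x : ℕ} (e∈ : e ∈ E K₁) (x∈ : x ∈ E K₂) (same-type : h₁ e ≡ h₂ x)
  (S : List Vtx) (S-sub : Subsingleton S)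
  (c₁ : cxt T K₁ h₁ e ⊆ S) (c₂ : cxt T K₂ h₂ x ⊆ S) where

  private
    module P₁ = PatchFacts C M K₁ p₁
    module P₂ = PatchFacts C M K₂ p₂
    module A₁ = AdherenceFacts C M K₁ T h₁ ad₁ e∈
    module A₂ = AdherenceFacts C M K₂ T h₂ ad₂ x∈

    not-□ : ∀ {v} → v ∈ V M → v ≡ □ → ⊥
    not-□ m eq = □∉M (subst (_∈ V M) eq m)

  same-source : s K₁ e ≡ s K₂ x
  same-source with P₁.source-side e∈ | P₂.source-side x∈
  ... | inj₁ c | inj₁ c' = S-sub (c₁ _ (cxt-source T K₁ h₁ e (A₁.source-in-C c)))
                                 (c₂ _ (cxt-source T K₂ h₂ x (A₂.source-in-C c')))
  ... | inj₁ c | inj₂ m' = ⊥-elim (not-□ m'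
    (trans (A₂.source-in-M m') (trans (cong (s T) (sym same-type)) (A₁.source-in-C c))))
  ... | inj₂ m | inj₁ c' = ⊥-elim (not-□ m
    (trans (A₁.source-in-M m) (trans (cong (s T) same-type) (A₂.source-in-C c'))))
  ... | inj₂ m | inj₂ m' =
    trans (A₁.source-in-M m) (trans (cong (s T) same-type) (sym (A₂.source-in-M m')))

  same-target : t K₁ e ≡ t K₂ x
  same-target with P₁.target-side e∈ | P₂.target-side x∈
  ... | inj₁ c | inj₁ c' = S-sub (c₁ _ (target-in-cxt C M K₁ T h₁ □∉M p₁ ad₁ e∈ c))
                                 (c₂ _ (target-in-cxt C M K₂ T h₂ □∉M p₂ ad₂ x∈ c'))
  ... | inj₁ c | inj₂ m' = ⊥-elim (not-□ m'
    (trans (A₂.target-in-M m') (trans (cong (t T) (sym same-type)) (A₁.target-in-C c))))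
  ... | inj₂ m | inj₁ c' = ⊥-elim (not-□ m
    (trans (A₁.target-in-M m) (trans (cong (t T) same-type) (A₂.target-in-C c'))))
  ... | inj₂ m | inj₂ m' =
    trans (A₁.target-in-M m) (trans (cong (t T) same-type) (sym (A₂.target-in-M m')))

FibreBij : Rule A → (J J' : Graph A) (hL hR : ℕ → ℕ) → ℕ → (ℕ → ℕ) → Set
FibreBij r J J' hL hR te σ =
  Bij (λ e → e ∈ E J' × hR e ≡ te) (λ e → e ∈ E J × hL e ≡ τ r te) σ ×
  (∀ e → e ∈ E J' → hR e ≡ te →
     (ℓ J' e ≡ ℓ J (σ e)) × (cxt (TR r) J' hR e ⊆ cxt (TL r) J hL (σ e)))

-- What a step C ·_J P_L → C ·_J' P_R provides, for a given adherence map hL of J,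
-- with the fibrewise bijections glued into a single map σ : E J' → E J.
record Trace (C : Graph A) (r : Rule A) (J : Graph A) (hL : ℕ → ℕ) (J' : Graph A) : Set where
  field
    patch  : IsPatch C (PR r) J'
    hR     : ℕ → ℕ
    adhR   : AdherenceMap C (PR r) J' (TR r) hR
    σ      : ℕ → ℕ
    σ-maps : ∀ e → e ∈ E J' → σ e ∈ E J × hL (σ e) ≡ τ r (hR e)
    σ-inj  : ∀ e e' → e ∈ E J' → e' ∈ E J' → hR e ≡ hR e' → σ e ≡ σ e' → e ≡ e'
    σ-onto : ∀ te → te ∈ E (TR r) → ∀ d → d ∈ E J → hL d ≡ τ r te →
             Σ ℕ λ e → (e ∈ E J' × hR e ≡ te) × σ e ≡ d
    σ-ℓ    : ∀ e → e ∈ E J' → ℓ J' e ≡ ℓ J (σ e)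
    σ-cxt  : ∀ e → e ∈ E J' → cxt (TR r) J' hR e ⊆ cxt (TL r) J hL (σ e)

module Glue (r : Rule A) (J J' : Graph A) (hL hR : ℕ → ℕ)
  (fibres : ∀ te → te ∈ E (TR r) → Σ (ℕ → ℕ) (FibreBij r J J' hL hR te)) where

  σ-at : ℕ → ℕ → ℕ
  σ-at te with te ∈E? E (TR r)
  ... | yes q = proj₁ (fibres te q)
  ... | no _ = λ e → e

  σ-at-spec : ∀ te → te ∈ E (TR r) → FibreBij r J J' hL hR te (σ-at te)
  σ-at-spec te q' with te ∈E? E (TR r)
  ... | yes q = proj₂ (fibres te q)
  ... | no ¬q = ⊥-elim (¬q q')

-- a rewrite step yields an adherence map of J and the trace over it;
-- σ e is σ_te e for te = hR e, which lies in T_R by adherence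
trace-of : (R : PatchGRS A) (C : Graph A) (r : Rule A) (J J' : Graph A) →
  RewriteStep R C r J J' →
  Σ (ℕ → ℕ) λ hL → AdherenceMap C (PL r) J (TL r) hL × Trace C r J hL J'
trace-of _ _ r J J' (_ , _ , patch , hL , hR , adhL , adhR , fibres) =
  hL , adhL , record
    { patch = patch ; hR = hR ; adhR = adhR ; σ = σ
    ; σ-maps = λ e p → proj₁ (bij e p) e (p , refl)
    ; σ-inj = λ e e' p p' w eq →
        proj₁ (proj₂ (bij e p)) e e' (p , refl) (p' , sym w)
          (trans eq (cong (λ te → σ-at te e') (sym w)))
    ; σ-onto = σ-onto
    ; σ-ℓ = λ e p → proj₁ (proj₂ (spec e p) e p refl)
    ; σ-cxt = λ e p → proj₂ (proj₂ (spec e p) e p refl) }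
  where
  open Glue r J J' hL hR fibres
  σ : ℕ → ℕ
  σ e = σ-at (hR e) e
  spec : ∀ e → e ∈ E J' → FibreBij r J J' hL hR (hR e) (σ-at (hR e))
  spec e p = σ-at-spec (hR e) (proj₁ (adhR e p))
  bij : ∀ e → e ∈ E J' →
    Bij (λ x → x ∈ E J' × hR x ≡ hR e) (λ d → d ∈ E J × hL d ≡ τ r (hR e)) (σ-at (hR e))
  bij e p = proj₁ (spec e p)
  σ-onto : ∀ te → te ∈ E (TR r) → ∀ d → d ∈ E J → hL d ≡ τ r te →
           Σ ℕ λ e → (e ∈ E J' × hR e ≡ te) × σ e ≡ d
  σ-onto te q d d∈ hd with proj₂ (proj₂ (proj₁ (σ-at-spec te q))) d (d∈ , hd)
  ... | e , (p , w) , eq = e , (p , w) , trans (cong (λ te' → σ-at te' e) w) eq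

retarget : {C : Graph A} {r : Rule A} {J J' : Graph A} {h h' : ℕ → ℕ} →
  (∀ d → d ∈ E J → h d ≡ h' d) → Trace C r J h J' → Trace C r J h' J'
retarget {r = r} {J} {J'} {h} {h'} agree tr = record
  { patch = patch ; hR = hR ; adhR = adhR ; σ = σ
  ; σ-maps = λ e p → let (d∈ , over) = σ-maps e p in d∈ , trans (sym (agree _ d∈)) over
  ; σ-inj = σ-inj
  ; σ-onto = λ te q d d∈ eq → σ-onto te q d d∈ (trans (agree d d∈) eq)
  ; σ-ℓ = σ-ℓ
  ; σ-cxt = λ e p → subst (cxt (TR r) J' hR e ⊆_)
      (cxt-cong (TL r) J h h' (σ e) (agree _ (proj₁ (σ-maps e p)))) (σ-cxt e p) }
  where open Trace tr

match : {C : Graph A} {r : Rule A} {J : Graph A} {hL : ℕ → ℕ} {J₁ J₂ : Graph A} →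
  (tr₁ : Trace C r J hL J₁) (tr₂ : Trace C r J hL J₂) → ∀ e → e ∈ E J₁ →
  Σ ℕ λ x → (x ∈ E J₂ × Trace.hR tr₂ x ≡ Trace.hR tr₁ e) × Trace.σ tr₂ x ≡ Trace.σ tr₁ e
match tr₁ tr₂ e p =
  Trace.σ-onto tr₂ (hR e) (proj₁ (adhR e p)) (σ e) (proj₁ (σ-maps e p)) (proj₂ (σ-maps e p))
  where open Trace tr₁

module TraceIso {C : Graph A} {r : Rule A} {J : Graph A} {hL : ℕ → ℕ} {J₁ J₂ : Graph A}
  (□∉PR : ¬ □ ∈ V (PR r)) (tr₁ : Trace C r J hL J₁) (tr₂ : Trace C r J hL J₂) where

  private
    module T₁ = Trace tr₁
    module T₂ = Trace tr₂

  -- ψ = σ₂⁻¹ ∘ σ₁ on the edges of J₁ (its value elsewhere is irrelevant)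
  ψ : ℕ → ℕ
  ψ e with e ∈E? E J₁
  ... | yes p = proj₁ (match tr₁ tr₂ e p)
  ... | no _ = e

  ψ-spec : ∀ e → e ∈ E J₁ → (ψ e ∈ E J₂ × T₂.hR (ψ e) ≡ T₁.hR e) × T₂.σ (ψ e) ≡ T₁.σ e
  ψ-spec e p' with e ∈E? E J₁
  ... | yes p = proj₂ (match tr₁ tr₂ e p)
  ... | no ¬p = ⊥-elim (¬p p')

  ψ-∈ : ∀ e → e ∈ E J₁ → ψ e ∈ E J₂
  ψ-∈ e p = proj₁ (proj₁ (ψ-spec e p))

  hR-ψ : ∀ e → e ∈ E J₁ → T₂.hR (ψ e) ≡ T₁.hR e
  hR-ψ e p = proj₂ (proj₁ (ψ-spec e p))

  σ-ψ : ∀ e → e ∈ E J₁ → T₂.σ (ψ e) ≡ T₁.σ e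
  σ-ψ e p = proj₂ (ψ-spec e p)

  ψ-inj : ∀ e e' → e ∈ E J₁ → e' ∈ E J₁ → ψ e ≡ ψ e' → e ≡ e'
  ψ-inj e e' p p' eq = T₁.σ-inj e e' p p' same-hR same-σ
    where
    open ≡-Reasoning
    same-hR : T₁.hR e ≡ T₁.hR e'
    same-hR = begin
      T₁.hR e       ≡⟨ sym (hR-ψ e p) ⟩
      T₂.hR (ψ e)   ≡⟨ cong T₂.hR eq ⟩
      T₂.hR (ψ e')  ≡⟨ hR-ψ e' p' ⟩
      T₁.hR e'      ∎
    same-σ : T₁.σ e ≡ T₁.σ e'
    same-σ = begin
      T₁.σ e        ≡⟨ sym (σ-ψ e p) ⟩
      T₂.σ (ψ e)    ≡⟨ cong T₂.σ eq ⟩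
      T₂.σ (ψ e')   ≡⟨ σ-ψ e' p' ⟩
      T₁.σ e'       ∎

  -- ψ is onto because matching in the opposite direction hits every J₂-edge
  ψ-onto : ∀ x → x ∈ E J₂ → Σ ℕ λ e → e ∈ E J₁ × ψ e ≡ x
  ψ-onto x q with match tr₂ tr₁ x q
  ... | e , (p , same-hR) , same-σ =
    e , p , T₂.σ-inj (ψ e) x (ψ-∈ e p) q (trans (hR-ψ e p) same-hR) (trans (σ-ψ e p) same-σ)

  -- both context sets shrink into the subsingleton context set of σ₁ e
  ψ-agree : ∀ e → e ∈ E J₁ → EdgeAgree J₂ (ψ e) J₁ e
  ψ-agree e p = agreeing same-source same-target same-label
    where
    open SameEndpoints C (PR r) (TR r) □∉PR J₂ J₁ T₂.patch T₁.patch T₂.adhR T₁.adhR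
      (ψ-∈ e p) p (hR-ψ e p) (cxt (TL r) J hL (T₁.σ e))
      (cxt-subsingleton (TL r) J hL (T₁.σ e))
      (λ a a∈ → subst (a ∈_) (cong (cxt (TL r) J hL) (σ-ψ e p)) (T₂.σ-cxt (ψ e) (ψ-∈ e p) a a∈))
      (T₁.σ-cxt e p)
    open ≡-Reasoning
    same-label : ℓ J₂ (ψ e) ≡ ℓ J₁ e
    same-label = begin
      ℓ J₂ (ψ e)         ≡⟨ T₂.σ-ℓ (ψ e) (ψ-∈ e p) ⟩
      ℓ J (T₂.σ (ψ e))   ≡⟨ cong (ℓ J) (σ-ψ e p) ⟩
      ℓ J (T₁.σ e)       ≡⟨ sym (T₁.σ-ℓ e p) ⟩
      ℓ J₁ e             ∎

  edge-iso : EdgeIso J₁ J₂ ψ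
  edge-iso = (ψ-∈ , ψ-inj , ψ-onto) , ψ-agree

simple-image : (G H : Graph A) (φ : Renaming) → RenamingFor φ G → IsImage φ G H →
  Simple G → Simple H
simple-image G H φ (V⊆ , _) (_ , edges , incidence) simple e e' e∈ e'∈ s≡ t≡ ℓ≡
  with proj₁ (edges e) e∈ | proj₁ (edges e') e'∈
... | d , d∈ , refl | d' , d'∈ , refl = cong (φE φ) (simple d d' d∈ d'∈ s-d t-d ℓ-d)
  where
  injV = proj₁ (proj₂ (bijV φ))
  inc = incidence d d∈
  inc' = incidence d' d'∈
  s-d : s G d ≡ s G d'
  s-d = injV _ _ (V⊆ _ (s∈V G d d∈)) (V⊆ _ (s∈V G d' d'∈))
          (trans (sym (proj₁ inc)) (trans s≡ (proj₁ inc')))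
  t-d : t G d ≡ t G d'
  t-d = injV _ _ (V⊆ _ (t∈V G d d∈)) (V⊆ _ (t∈V G d' d'∈))
          (trans (sym (proj₁ (proj₂ inc))) (trans t≡ (proj₁ (proj₂ inc'))))
  ℓ-d : ℓ G d ≡ ℓ G d'
  ℓ-d = trans (sym (proj₂ (proj₂ inc))) (trans ℓ≡ (proj₂ (proj₂ inc')))

closure-simple : (R : PatchGRS A) (r : Rule A) → (R ≈-closure) r → Simple (TL r)
closure-simple R r (r₀ , r₀∈R , φ , _ , _ , _ , forTL , _ , _ , _ , imTL , _ , _ , _) =
  simple-image (TL r₀) (TL r) φ forTL imTL (proj₂ (proj₂ R r₀ r₀∈R))

-- P_R avoids □ since T_R is a patch type for it (context □); a renaming
-- fixing □ preserves this
closure-□∉PR : (R : PatchGRS A) (r : Rule A) → (R ≈-closure) r → ¬ □ ∈ V (PR r)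
closure-□∉PR R r (r₀ , r₀∈R , φ , □∈V₁ , φ□ , _ , _ , forPR , _ , _ , _ , imPR , _ , _) □∈
  with proj₁ (proj₁ imPR □) □∈
... | u , u∈ , φu≡□ = □∉PR₀ (subst (_∈ V (PR r₀)) u≡□ u∈)
  where
  □∉PR₀ : ¬ □ ∈ V (PR r₀)
  □∉PR₀ = PatchFacts.disjoint-V Box (PR r₀) (TR r₀)
            (proj₁ (proj₂ (proj₁ (proj₂ R r₀ r₀∈R)))) (here refl)
  u≡□ : u ≡ □
  u≡□ = proj₁ (proj₂ (bijV φ)) u □ (proj₁ forPR u u∈) □∈V₁ (trans φu≡□ (sym φ□))

proposition2 : {k : ℕ} → (R : PatchGRS (Fin (suc k))) →
    (C : Graph (Fin (suc k))) → (r : Rule (Fin (suc k))) → (R ≈-closure) r →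
    (J : Graph (Fin (suc k))) → IsPatch C (PL r) J →
    (J' J'' : Graph (Fin (suc k))) →
    RewriteStep R C r J J' → RewriteStep R C r J J'' →
    (C ·[ J' ] PR r) ≈ (C ·[ J'' ] PR r)
proposition2 R C r r∈R J pJ J' J'' step' step''
  with trace-of R C r J J' step' | trace-of R C r J J'' step''
... | hL' , adhL' , tr' | hL'' , adhL'' , tr'' =
  Composition.composition-≈ C (PR r) J' J'' (Trace.patch tr') (Trace.patch tr'') ψ edge-iso
  where
  -- T_L is simple, so both steps see J through the same adherence map
  same-hL : ∀ d → d ∈ E J → hL'' d ≡ hL' d
  same-hL = adherence-unique C (PL r) J (TL r) pJ (closure-simple R r r∈R) adhL'' adhL'
  open TraceIso (closure-□∉PR R r r∈R) tr' (retarget same-hL tr'')
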